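{- Let $G$ be a very well-covered graph and let $q=3$ or $q\geq 5$. No edge lying on a chordless cycle of length $q$ in $G$ belongs to a perfect matching of $G$.
   Context: All graphs are finite and simple. $\alpha(G)$ is the maximum size of a stable set. $G$ is well-covered if all maximal stable sets have the same size; very well-covered if moreover it has no isolated vertices and $|V(G)|=2\alpha(G)$. A chordless cycle is a cycle that is an induced subgraph. -}

module Defs where

open import Data.Nat using (ℕ; zero; suc; _+_; _*_; _≤_)
open import Data.Fin using (Fin; toℕ)
open import Data.Fin.Subset using (Subset; _∈_; _∉_; ∣_∣)
open import Data.Sum using (_⊎_)
open import Data.Product using (Σ; ∃; _×_; _,_)
open import Relation.Binary.PropositionalEquality using (_≡_)
open import Relation.Nullary using (¬_)
open import Level using (0ℓ)
open import Function.Definitions using (Injective)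

record Graph (n : ℕ) : Set₁ where
  field
    Adj       : Fin n → Fin n → Set
    sym       : ∀ {u v} → Adj u v → Adj v u
    irrefl    : ∀ {v} → ¬ Adj v v

open Graph public

module _ {n : ℕ} (G : Graph n) where

  Stable : Subset n → Set
  Stable S = ∀ {u v} → u ∈ S → v ∈ S → ¬ Adj G u v

  MaximalStable : Subset n → Set
  MaximalStable S = Stable S × (∀ v → v ∉ S → ∃ λ u → u ∈ S × Adj G u v)

  IsAlpha : ℕ → Set
  IsAlpha k = (∃ λ S → Stable S × ∣ S ∣ ≡ k) × (∀ S → Stable S → ∣ S ∣ ≤ k)

  WellCovered : Set
  WellCovered = ∀ S T → MaximalStable S → MaximalStable T → ∣ S ∣ ≡ ∣ T ∣

  NoIsolated : Set
  NoIsolated = ∀ v → ∃ λ u → Adj G v u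

  VeryWellCovered : Set
  VeryWellCovered = WellCovered × NoIsolated × (∃ λ k → IsAlpha k × n ≡ 2 * k)

  record PerfectMatching : Set where
    field
      partner     : Fin n → Fin n
      partner-adj : ∀ v → Adj G v (partner v)
      partner-inv : ∀ v → partner (partner v) ≡ v

  InMatching : PerfectMatching → Fin n → Fin n → Set
  InMatching M u v = PerfectMatching.partner M u ≡ v

  CyclicSucc : (q : ℕ) → Fin q → Fin q → Set
  CyclicSucc q i j = (toℕ j ≡ suc (toℕ i)) ⊎ (suc (toℕ i) ≡ q × toℕ j ≡ 0)

  CyclicAdjIdx : (q : ℕ) → Fin q → Fin q → Set
  CyclicAdjIdx q i j = CyclicSucc q i j ⊎ CyclicSucc q j i

  record ChordlessCycle (q : ℕ) : Set where
    field
      three≤q   : 3 ≤ q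
      vert      : Fin q → Fin n
      injective : Injective _≡_ _≡_ vert
      adj-iff   : ∀ i j → (Adj G (vert i) (vert j) → CyclicAdjIdx q i j)
                          × (CyclicAdjIdx q i j → Adj G (vert i) (vert j))

  EdgeOnCycle : ∀ {q} → ChordlessCycle q → Fin n → Fin n → Set
  EdgeOnCycle {q} C u v = ∃ λ i → ∃ λ j → CyclicAdjIdx q i j
                            × ChordlessCycle.vert C i ≡ u × ChordlessCycle.vert C j ≡ v

module Submission where

-- Let G be very well-covered with α(G) = k and |V(G)| = 2k, and let M be a
-- perfect matching with partner function m.
--
-- Key lemma (matched-neighbours-adjacent): if x is a vertex, a ∼ x and
-- b ∼ m(x), then a and b are adjacent.  Otherwise {a, b} is stable; extend
-- it greedily to a maximal stable set S.  Then x, m(x) ∉ S, and since G is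
-- well-covered, |S| ≥ k.  The set U = S ∪ {x} contains no edge of M, so U is
-- disjoint from its image under the involution m, whence 2|U| ≤ 2k; but
-- |U| = |S| + 1 > k.
--
-- For the theorem, let i → j be an edge of a chordless q-cycle with
-- partner(c i) = c j.  Take the cyclic predecessor a of i and the successor b
-- of j.  Then c a ∼ c i and c b ∼ c j, so c a ∼ c b by the key lemma; but
-- a and b are three steps apart on the cycle, hence not adjacent unless q = 4.
--
-- Adjacency is not assumed decidable.  Since every goal is a negation, we
-- may use decidability of the (finite) adjacency relation under ¬¬.

open import Defs
open import Data.Nat using (ℕ; zero; suc; _+_; _*_; _∸_; _≤_; _<_; _≥_; s≤s)
open import Data.Nat.Properties
  using (+-0-commutativeMonoid; +-identityʳ; +-monoʳ-≤; m+[n∸m]≡n; ≤-<-trans;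
         <⇒≱; *-cancelˡ-≤; _<?_; ≤-antisym; ≮⇒≥; module ≤-Reasoning)
open import Data.Bool using (Bool; true; false)
open import Data.Fin using (Fin; zero; suc; toℕ; fromℕ; fromℕ<; inject₁)
open import Data.Fin.Properties using (any?; toℕ-fromℕ; toℕ-fromℕ<; toℕ-inject₁; toℕ<n)
open import Data.Fin.Subset using (Subset; _∈_; _∉_; ∣_∣; _⊆_; _∪_; ⁅_⁆; ∁)
open import Data.Fin.Subset.Properties
  using (x∉p⇒x∈∁p; p⊆q⇒∣p∣≤∣q∣; ∣∁p∣≡n∸∣p∣; ∣p∣≤n; _∈?_; x∈⁅x⁆; x∈⁅y⁆⇒x≡y;
         p⊆p∪q; q⊆p∪q; x∈p∪q⁻; p⊂q⇒∣p∣<∣q∣)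
open import Data.Fin.Permutation using (permutation)
open import Data.Vec using ([]; _∷_; lookup; tabulate)
open import Data.Vec.Properties using ([]=⇒lookup; lookup⇒[]=; lookup∘tabulate)
open import Data.List using (List; []; _∷_; allFin)
open import Data.List.Membership.Propositional using () renaming (_∈_ to _∈ₗ_)
open import Data.List.Membership.Propositional.Properties using (∈-allFin)
open import Data.List.Relation.Unary.Any using (here; there)
open import Data.Product using (∃; _×_; _,_; proj₁; proj₂)
open import Data.Sum using (_⊎_; inj₁; inj₂)
open import Data.Empty using (⊥; ⊥-elim)
open import Function using (_∘_)
open import Relation.Nullary using (¬_; Dec; yes; no; _×-dec_)
open import Relation.Nullary.Decidable using (¬¬-excluded-middle)
open import Relation.Binary.PropositionalEquality
  using (_≡_; refl; cong; subst; trans; module ≡-Reasoning)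
  renaming (sym to ≡-sym)
open import Algebra.Properties.CommutativeMonoid.Sum +-0-commutativeMonoid
  using (sum; sum-permute; sum-cong-≗)

indicator : Bool → ℕ
indicator true  = 1
indicator false = 0

∣p∣≡sum-indicator : ∀ {n} (p : Subset n) → ∣ p ∣ ≡ sum (indicator ∘ lookup p)
∣p∣≡sum-indicator []          = refl
∣p∣≡sum-indicator (true ∷ p)  = cong suc (∣p∣≡sum-indicator p)
∣p∣≡sum-indicator (false ∷ p) = ∣p∣≡sum-indicator p

preimage : ∀ {n} → (Fin n → Fin n) → Subset n → Subset n
preimage f p = tabulate (lookup p ∘ f)

∈-preimage : ∀ {n} (f : Fin n → Fin n) (p : Subset n) {i} → i ∈ preimage f p → f i ∈ p
∈-preimage f p {i} i∈ =
  lookup⇒[]= (f i) p (trans (≡-sym (lookup∘tabulate (lookup p ∘ f) i)) ([]=⇒lookup i∈))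

∣preimage∣ : ∀ {n} (f g : Fin n → Fin n) →
             (∀ y → f (g y) ≡ y) → (∀ x → g (f x) ≡ x) →
             (p : Subset n) → ∣ preimage f p ∣ ≡ ∣ p ∣
∣preimage∣ f g fg gf p = begin
  ∣ preimage f p ∣                           ≡⟨ ∣p∣≡sum-indicator (preimage f p) ⟩
  sum (indicator ∘ lookup (preimage f p))    ≡⟨ sum-cong-≗ (cong indicator ∘ lookup∘tabulate (lookup p ∘ f)) ⟩
  sum (indicator ∘ lookup p ∘ f)             ≡⟨ ≡-sym (sum-permute (indicator ∘ lookup p) (permutation f g fg gf)) ⟩
  sum (indicator ∘ lookup p)                 ≡⟨ ≡-sym (∣p∣≡sum-indicator p) ⟩
  ∣ p ∣                                      ∎
  where open ≡-Reasoning

-- If a subset p is disjoint from its preimage under a bijection f (e.g. p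
-- contains no pair {i, f i} of an involution), then p fills at most half of
-- Fin n: the preimage lies in the complement of p and has the same size.
disjoint-preimage-bound : ∀ {n} (f g : Fin n → Fin n) →
                          (∀ y → f (g y) ≡ y) → (∀ x → g (f x) ≡ x) →
                          (p : Subset n) → (∀ i → i ∈ p → f i ∉ p) →
                          2 * ∣ p ∣ ≤ n
disjoint-preimage-bound {n} f g fg gf p disjoint = begin
  2 * ∣ p ∣                  ≡⟨ cong (∣ p ∣ +_) (+-identityʳ ∣ p ∣) ⟩
  ∣ p ∣ + ∣ p ∣              ≡⟨ cong (∣ p ∣ +_) (≡-sym (∣preimage∣ f g fg gf p)) ⟩
  ∣ p ∣ + ∣ preimage f p ∣   ≤⟨ +-monoʳ-≤ ∣ p ∣ (p⊆q⇒∣p∣≤∣q∣ preimage⊆∁p) ⟩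
  ∣ p ∣ + ∣ ∁ p ∣            ≡⟨ cong (∣ p ∣ +_) (∣∁p∣≡n∸∣p∣ p) ⟩
  ∣ p ∣ + (n ∸ ∣ p ∣)        ≡⟨ m+[n∸m]≡n (∣p∣≤n p) ⟩
  n                          ∎
  where
  open ≤-Reasoning
  preimage⊆∁p : preimage f p ⊆ ∁ p
  preimage⊆∁p {i} i∈ = x∉p⇒x∈∁p (λ i∈p → disjoint i i∈p (∈-preimage f p i∈))

¬¬-∀-Fin : ∀ n {P : Fin n → Set} → (∀ i → ¬ ¬ P i) → ¬ ¬ (∀ i → P i)
¬¬-∀-Fin zero    h ¬∀ = ¬∀ (λ ())
¬¬-∀-Fin (suc n) h ¬∀ =
  h zero (λ p₀ → ¬¬-∀-Fin n (h ∘ suc) (λ pₛ → ¬∀ λ { zero → p₀ ; (suc i) → pₛ i }))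

¬¬-decidable : ∀ {n} (R : Fin n → Fin n → Set) → ¬ ¬ (∀ x y → Dec (R x y))
¬¬-decidable {n} R = ¬¬-∀-Fin n (λ x → ¬¬-∀-Fin n (λ y → ¬¬-excluded-middle))

module Greedy {n : ℕ} (G : Graph n) (adj? : ∀ u v → Dec (Adj G u v)) where

  Dominated : Subset n → Fin n → Set
  Dominated S v = ∃ λ u → u ∈ S × Adj G u v

  dominated? : ∀ S v → Dec (Dominated S v)
  dominated? S v = any? (λ u → (u ∈? S) ×-dec adj? u v)

  Covered : Subset n → Fin n → Set
  Covered S v = v ∈ S ⊎ Dominated S v

  Covered-mono : ∀ {S T v} → S ⊆ T → Covered S v → Covered T v
  Covered-mono S⊆T (inj₁ v∈S)            = inj₁ (S⊆T v∈S)
  Covered-mono S⊆T (inj₂ (u , u∈S , uv)) = inj₂ (u , S⊆T u∈S , uv)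

  step : Subset n → Fin n → Subset n
  step S v with dominated? S v
  ... | yes _ = S
  ... | no  _ = S ∪ ⁅ v ⁆

  step-⊆ : ∀ S v → S ⊆ step S v
  step-⊆ S v with dominated? S v
  ... | yes _ = λ x∈ → x∈
  ... | no  _ = p⊆p∪q ⁅ v ⁆

  step-covers : ∀ S v → Covered (step S v) v
  step-covers S v with dominated? S v
  ... | yes dom = inj₂ dom
  ... | no  _   = inj₁ (q⊆p∪q S ⁅ v ⁆ (x∈⁅x⁆ v))

  step-stable : ∀ S v → Stable G S → Stable G (step S v)
  step-stable S v stable with dominated? S v
  ... | yes _      = stable
  ... | no  ¬dom = λ x∈ y∈ → added (x∈p∪q⁻ S ⁅ v ⁆ x∈) (x∈p∪q⁻ S ⁅ v ⁆ y∈)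
    where
    added : ∀ {x y} → x ∈ S ⊎ x ∈ ⁅ v ⁆ → y ∈ S ⊎ y ∈ ⁅ v ⁆ → ¬ Adj G x y
    added (inj₁ x∈S) (inj₁ y∈S) = stable x∈S y∈S
    added {x} (inj₁ x∈S) (inj₂ y∈v) xy with x∈⁅y⁆⇒x≡y v y∈v
    ... | refl = ¬dom (x , x∈S , xy)
    added {y = y} (inj₂ x∈v) (inj₁ y∈S) xy with x∈⁅y⁆⇒x≡y v x∈v
    ... | refl = ¬dom (y , y∈S , Graph.sym G xy)
    added (inj₂ x∈v) (inj₂ y∈v) xy with x∈⁅y⁆⇒x≡y v x∈v | x∈⁅y⁆⇒x≡y v y∈v
    ... | refl | refl = Graph.irrefl G xy

  sweep : Subset n → List (Fin n) → Subset n
  sweep S []       = S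
  sweep S (v ∷ vs) = sweep (step S v) vs

  sweep-⊆ : ∀ S vs → S ⊆ sweep S vs
  sweep-⊆ S []       x∈ = x∈
  sweep-⊆ S (v ∷ vs) x∈ = sweep-⊆ (step S v) vs (step-⊆ S v x∈)

  sweep-stable : ∀ S vs → Stable G S → Stable G (sweep S vs)
  sweep-stable S []       stable = stable
  sweep-stable S (v ∷ vs) stable = sweep-stable (step S v) vs (step-stable S v stable)

  sweep-covers : ∀ S vs {v} → v ∈ₗ vs → Covered (sweep S vs) v
  sweep-covers S (w ∷ vs) (here refl) = Covered-mono (sweep-⊆ (step S w) vs) (step-covers S w)
  sweep-covers S (w ∷ vs) (there v∈) = sweep-covers (step S w) vs v∈

  extend-to-maximal : ∀ B → Stable G B → ∃ λ S → B ⊆ S × MaximalStable G S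
  extend-to-maximal B stable =
    S , sweep-⊆ B (allFin n) , sweep-stable B (allFin n) stable , dominates
    where
    S : Subset n
    S = sweep B (allFin n)
    dominates : ∀ v → v ∉ S → Dominated S v
    dominates v v∉S with sweep-covers B (allFin n) (∈-allFin v)
    ... | inj₁ v∈S = ⊥-elim (v∉S v∈S)
    ... | inj₂ dom = dom

-- In a well-covered graph every maximal stable set has size at least (in
-- fact exactly) α(G): compare it with a maximal extension of a maximum
-- stable set.
maximal-stable-size : ∀ {n} (G : Graph n) → (∀ u v → Dec (Adj G u v)) →
  WellCovered G → ∀ {k} → IsAlpha G k → ∀ {S} → MaximalStable G S → k ≤ ∣ S ∣
maximal-stable-size G adj? wc ((A , stableA , ∣A∣≡k) , _) {S} maxS
  with Greedy.extend-to-maximal G adj? A stableA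
... | T , A⊆T , maxT =
  subst (_≤ ∣ S ∣) ∣A∣≡k (subst (∣ A ∣ ≤_) (wc T S maxT maxS) (p⊆q⇒∣p∣≤∣q∣ A⊆T))

module _ {n : ℕ} (G : Graph n) (M : PerfectMatching G) where
  open PerfectMatching M

  no-matched-pair : ∀ S x → Stable G S → partner x ∉ S →
                    ∀ i → i ∈ S ∪ ⁅ x ⁆ → partner i ∉ S ∪ ⁅ x ⁆
  no-matched-pair S x stable mx∉S i i∈ mi∈ = go (x∈p∪q⁻ S ⁅ x ⁆ i∈) (x∈p∪q⁻ S ⁅ x ⁆ mi∈)
    where
    go : i ∈ S ⊎ i ∈ ⁅ x ⁆ → partner i ∈ S ⊎ partner i ∈ ⁅ x ⁆ → ⊥
    go (inj₁ i∈S) (inj₁ mi∈S) = stable i∈S mi∈S (partner-adj i)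
    go (inj₁ i∈S) (inj₂ mi∈x) =
      mx∉S (subst (_∈ S) (trans (≡-sym (partner-inv i)) (cong partner (x∈⁅y⁆⇒x≡y x mi∈x))) i∈S)
    go (inj₂ i∈x) (inj₁ mi∈S) with x∈⁅y⁆⇒x≡y x i∈x
    ... | refl = mx∉S mi∈S
    go (inj₂ i∈x) (inj₂ mi∈x) with x∈⁅y⁆⇒x≡y x i∈x | x∈⁅y⁆⇒x≡y x mi∈x
    ... | refl | mi≡i = Graph.irrefl G (subst (Adj G i) mi≡i (partner-adj i))

  no-stable-neighbours : (∀ u v → Dec (Adj G u v)) → WellCovered G →
    ∀ {k} → IsAlpha G k → n ≡ 2 * k →
    ∀ x B → Stable G B → ∀ {a b} → a ∈ B → Adj G a x → b ∈ B → Adj G b (partner x) → ⊥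
  no-stable-neighbours adj? wc {k} α≡k n≡2k x B stableB a∈B ax b∈B by
    with Greedy.extend-to-maximal G adj? B stableB
  ... | S , B⊆S , maxS = <⇒≱ k<∣U∣ ∣U∣≤k
    where
    U : Subset n
    U = S ∪ ⁅ x ⁆
    x∉S : x ∉ S
    x∉S x∈S = proj₁ maxS (B⊆S a∈B) x∈S ax
    mx∉S : partner x ∉ S
    mx∉S mx∈S = proj₁ maxS (B⊆S b∈B) mx∈S by
    k<∣U∣ : k < ∣ U ∣
    k<∣U∣ = ≤-<-trans (maximal-stable-size G adj? wc α≡k maxS)
      (p⊂q⇒∣p∣<∣q∣ (p⊆p∪q ⁅ x ⁆ , x , q⊆p∪q S ⁅ x ⁆ (x∈⁅x⁆ x) , x∉S))
    ∣U∣≤k : ∣ U ∣ ≤ k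
    ∣U∣≤k = *-cancelˡ-≤ 2 (subst (2 * ∣ U ∣ ≤_) n≡2k
      (disjoint-preimage-bound partner partner partner-inv partner-inv U
        (no-matched-pair S x (proj₁ maxS) mx∉S)))

  matched-neighbours-adjacent : VeryWellCovered G → ∀ x {a b} →
    Adj G a x → Adj G b (partner x) → ¬ ¬ Adj G a b
  matched-neighbours-adjacent (wc , _ , _ , α≡k , n≡2k) x {a} {b} ax by ¬ab =
    ¬¬-decidable (Adj G) λ adj? →
      no-stable-neighbours adj? wc α≡k n≡2k x B pair-stable a∈B ax b∈B by
    where
    B : Subset n
    B = ⁅ a ⁆ ∪ ⁅ b ⁆
    a∈B : a ∈ B
    a∈B = p⊆p∪q ⁅ b ⁆ (x∈⁅x⁆ a)
    b∈B : b ∈ B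
    b∈B = q⊆p∪q ⁅ a ⁆ ⁅ b ⁆ (x∈⁅x⁆ b)
    member : ∀ {v} → v ∈ B → v ≡ a ⊎ v ≡ b
    member v∈ with x∈p∪q⁻ ⁅ a ⁆ ⁅ b ⁆ v∈
    ... | inj₁ v∈a = inj₁ (x∈⁅y⁆⇒x≡y a v∈a)
    ... | inj₂ v∈b = inj₂ (x∈⁅y⁆⇒x≡y b v∈b)
    pair-stable : Stable G B
    pair-stable u∈ v∈ with member u∈ | member v∈
    ... | inj₁ refl | inj₁ refl = Graph.irrefl G
    ... | inj₁ refl | inj₂ refl = ¬ab
    ... | inj₂ refl | inj₁ refl = ¬ab ∘ Graph.sym G
    ... | inj₂ refl | inj₂ refl = Graph.irrefl G

Step : ℕ → ℕ → ℕ → Set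
Step q s t = t ≡ suc s ⊎ (suc s ≡ q × t ≡ 0)

cyclic-predecessor : ∀ {q} (i : Fin q) → ∃ λ (a : Fin q) → Step q (toℕ a) (toℕ i)
cyclic-predecessor {suc q} zero    = fromℕ q , inj₂ (cong suc (toℕ-fromℕ q) , refl)
cyclic-predecessor {suc q} (suc i) = inject₁ i , inj₁ (cong suc (≡-sym (toℕ-inject₁ i)))

cyclic-successor : ∀ {q} (j : Fin q) → ∃ λ (b : Fin q) → Step q (toℕ j) (toℕ b)
cyclic-successor {suc q} j with suc (toℕ j) <? suc q
... | yes j+1<q = fromℕ< j+1<q , inj₁ (toℕ-fromℕ< j+1<q)
... | no  j+1≮q = zero , inj₂ (≤-antisym (toℕ<n j) (≮⇒≥ j+1≮q) , refl)

three-apart-not-adjacent : ∀ {q a i j b} → 3 ≤ q → ¬ q ≡ 4 →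
  Step q a i → Step q i j → Step q j b → ¬ (Step q a b ⊎ Step q b a)
three-apart-not-adjacent _ _ (inj₁ refl) (inj₁ refl) (inj₁ refl) (inj₁ (inj₁ ()))
three-apart-not-adjacent _ _ (inj₁ refl) (inj₁ refl) (inj₁ refl) (inj₁ (inj₂ (refl , ())))
three-apart-not-adjacent _ _ (inj₁ refl) (inj₁ refl) (inj₁ refl) (inj₂ (inj₁ ()))
three-apart-not-adjacent _ q≢4 (inj₁ refl) (inj₁ refl) (inj₁ refl) (inj₂ (inj₂ (refl , refl))) = q≢4 refl
three-apart-not-adjacent _ _ (inj₁ refl) (inj₁ refl) (inj₂ (refl , refl)) (inj₁ (inj₁ ()))
three-apart-not-adjacent _ _ (inj₁ refl) (inj₁ refl) (inj₂ (refl , refl)) (inj₁ (inj₂ (() , refl)))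
three-apart-not-adjacent _ q≢4 (inj₁ refl) (inj₁ refl) (inj₂ (refl , refl)) (inj₂ (inj₁ refl)) = q≢4 refl
three-apart-not-adjacent _ _ (inj₁ refl) (inj₁ refl) (inj₂ (refl , refl)) (inj₂ (inj₂ (() , refl)))
three-apart-not-adjacent (s≤s (s≤s ())) _ (inj₁ refl) (inj₂ (refl , refl)) (inj₁ refl) (inj₁ (inj₁ refl))
three-apart-not-adjacent _ _ (inj₁ refl) (inj₂ (refl , refl)) (inj₁ refl) (inj₁ (inj₂ (_ , ())))
three-apart-not-adjacent _ q≢4 (inj₁ refl) (inj₂ (refl , refl)) (inj₁ refl) (inj₂ (inj₁ refl)) = q≢4 refl
three-apart-not-adjacent (s≤s (s≤s ())) _ (inj₁ refl) (inj₂ (refl , refl)) (inj₁ refl) (inj₂ (inj₂ (refl , refl)))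
three-apart-not-adjacent (s≤s (s≤s ())) _ (inj₂ (refl , refl)) (inj₁ refl) (inj₁ refl) (inj₁ (inj₁ refl))
three-apart-not-adjacent _ _ (inj₂ (refl , refl)) (inj₁ refl) (inj₁ refl) (inj₁ (inj₂ (refl , ())))
three-apart-not-adjacent _ q≢4 (inj₂ (refl , refl)) (inj₁ refl) (inj₁ refl) (inj₂ (inj₁ refl)) = q≢4 refl
three-apart-not-adjacent _ _ (inj₂ (refl , refl)) (inj₁ refl) (inj₁ refl) (inj₂ (inj₂ (refl , ())))
three-apart-not-adjacent _ _ (inj₂ (refl , refl)) (inj₁ refl) (inj₂ (refl , refl)) (inj₁ (inj₁ ()))
three-apart-not-adjacent (s≤s (s≤s ())) _ (inj₂ (refl , refl)) (inj₁ refl) (inj₂ (refl , refl)) (inj₁ (inj₂ (refl , refl)))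
three-apart-not-adjacent (s≤s (s≤s ())) _ (inj₂ (refl , refl)) (inj₁ refl) (inj₂ (refl , refl)) (inj₂ (inj₁ refl))

chordless-three-apart : ∀ {n} (G : Graph n) {q} (C : ChordlessCycle G q) → ¬ q ≡ 4 →
  ∀ {a i j b : Fin q} → Step q (toℕ a) (toℕ i) → Step q (toℕ i) (toℕ j) → Step q (toℕ j) (toℕ b) →
  ¬ Adj G (ChordlessCycle.vert C a) (ChordlessCycle.vert C b)
chordless-three-apart G C q≢4 {a} {b = b} ai ij jb ab =
  three-apart-not-adjacent (ChordlessCycle.three≤q C) q≢4 ai ij jb
    (proj₁ (ChordlessCycle.adj-iff C a b) ab)

-- The hypothesis q = 3 or q ≥ 5 is used only as q ≠ 4.
q≢4 : ∀ {q} → (q ≡ 3 ⊎ q ≥ 5) → ¬ q ≡ 4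
q≢4 (inj₁ refl) ()
q≢4 (inj₂ (s≤s (s≤s (s≤s (s≤s (s≤s _)))))) ()

-- An edge c i → c j of a chordless cycle of length ≠ 4, oriented along the
-- cycle, is in no perfect matching of a very well-covered graph: the
-- neighbours c a of c i and c b of c j on the cycle would have to be adjacent.
matched-cycle-edge : ∀ {n} (G : Graph n) → VeryWellCovered G → ∀ {q} → ¬ q ≡ 4 →
  (C : ChordlessCycle G q) (M : PerfectMatching G) → ∀ {i j} → CyclicSucc G q i j →
  ¬ PerfectMatching.partner M (ChordlessCycle.vert C i) ≡ ChordlessCycle.vert C j
matched-cycle-edge G vwc q≢4 C M {i} {j} i→j mi≡j
  with cyclic-predecessor i | cyclic-successor j
... | a , a→i | b , j→b =
  matched-neighbours-adjacent G M vwc (vert i)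
    (proj₂ (adj-iff a i) (inj₁ a→i))
    (subst (Adj G (vert b)) (≡-sym mi≡j) (proj₂ (adj-iff b j) (inj₂ j→b)))
    (chordless-three-apart G C q≢4 a→i i→j j→b)
  where open ChordlessCycle C

lemma3 : ∀ {n} (G : Graph n) → VeryWellCovered G →
    (q : ℕ) → (q ≡ 3 ⊎ q ≥ 5) →
    (C : ChordlessCycle G q) → (u v : Fin n) → EdgeOnCycle G C u v →
    (M : PerfectMatching G) → ¬ InMatching G M u v
lemma3 G vwc q q-range C _ _ (i , j , inj₁ i→j , refl , refl) M matched =
  matched-cycle-edge G vwc (q≢4 q-range) C M i→j matched
lemma3 G vwc q q-range C _ _ (i , j , inj₂ j→i , refl , refl) M matched =
  matched-cycle-edge G vwc (q≢4 q-range) C M j→i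
    (trans (cong partner (≡-sym matched)) (partner-inv (vert i)))
  where
  open ChordlessCycle C
  open PerfectMatching M
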